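{- For every distribution $p$ on $\mathcal{A}$ and every $x\in\mathcal{P}$, we have $h_p(x)\le c^\top x+z^{short}_p(x)+z^{long}_p(0)\le 2h_p(x)$.
   Context: $\mathcal{A}$ finite set of scenarios; $\mathcal{P}\subseteq\mathbb{R}^m_{\ge0}$ a polytope containing $0$; $c\ge0$; $g(x,A)\ge0$ with $g(x,A)\le g(0,A)\le g(x,A)+\lambda c^\top x$ for all $x\in\mathcal{P},A$, where $\lambda\ge1$. $\kappa_{sc}$ is a scenario metric ($\kappa_{sc}(A,A)=0$), $r>0$, $M=\lambda r$. For a distribution $p$ let $\Gamma_p$ be the set of $\gamma\in\mathbb{R}^{\mathcal{A}\times\mathcal{A}}_{\ge0}$ with $\sum_{A'}\gamma_{A,A'}\le p_A$ for all $A$ and $\sum_{A,A'}\kappa_{sc}(A,A')\gamma_{A,A'}\le r$. Define $z_p(x)=\max_{\gamma\in\Gamma_p}\sum_{A,A'}\gamma_{A,A'}g(x,A')$, $h_p(x)=c^\top x+z_p(x)$, $z^{short}_p(x)=\max\{\sum\gamma_{A,A'}g(x,A'):\gamma\in\Gamma_p,\ \gamma_{A,A'}=0\text{ whenever }\kappa_{sc}(A,A')>M\}$, and $z^{long}_p(x)=\max\{\sum\gamma_{A,A'}g(x,A'):\gamma\in\Gamma_p,\ \sum_{A,A'}\gamma_{A,A'}\le1/\lambda\}$. -}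

module Defs where

open import Data.Nat using (ℕ; zero; suc)
open import Data.Fin using (Fin; zero; suc)
open import Data.Product using (_×_; Σ; ∃; _,_)
open import Function using (_∘_)
open import Function.Bundles using (_⇔_)
open import Relation.Binary.PropositionalEquality using (_≡_)
open import Relation.Nullary using (¬_)
open import Algebra.Structures using (IsCommutativeRing)
open import Relation.Binary.Structures using (IsTotalOrder)

-- An ordered field (the real numbers are one; the statement is proved for
-- every ordered field).  Equality is propositional; the inverse is total
-- (value at 0 is unconstrained), as is common in formal libraries.
record OrderedField : Set₁ where
  infixl 6 _+_
  infixl 7 _*_
  infix 4 _≤_
  field
    Carrier : Set
    _+_ _*_ : Carrier → Carrier → Carrier
    -_ : Carrier → Carrier
    0# 1# : Carrier
    _⁻¹ : Carrier → Carrier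
    _≤_ : Carrier → Carrier → Set
    isCommutativeRing : IsCommutativeRing _≡_ _+_ _*_ -_ 0# 1#
    isTotalOrder : IsTotalOrder _≡_ _≤_
    0≢1 : ¬ (0# ≡ 1#)
    ⁻¹-inverse : ∀ x → ¬ (x ≡ 0#) → x * (x ⁻¹) ≡ 1#
    +-mono-≤ : ∀ {a b} c → a ≤ b → a + c ≤ b + c
    *-nonneg : ∀ {a b} → 0# ≤ a → 0# ≤ b → 0# ≤ a * b

module Ops (F : OrderedField) where
  open OrderedField F

  infix 4 _<_
  _<_ : Carrier → Carrier → Set
  a < b = (a ≤ b) × ¬ (a ≡ b)

  ∑ : ∀ {n} → (Fin n → Carrier) → Carrier
  ∑ {zero} f = 0#
  ∑ {suc n} f = f zero + ∑ (f ∘ suc)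

  Pt : ℕ → Set
  Pt m = Fin m → Carrier

  0v : ∀ {m} → Pt m
  0v _ = 0#

  dot : ∀ {m} → Pt m → Pt m → Carrier
  dot c x = ∑ (λ i → c i * x i)

  NonnegV : ∀ {m} → Pt m → Set
  NonnegV x = ∀ i → 0# ≤ x i

  InConvHull : ∀ {m k} → (Fin k → Pt m) → Pt m → Set
  InConvHull {m} {k} V x =
    Σ (Fin k → Carrier) λ μ →
      (∀ j → 0# ≤ μ j) × (∑ μ ≡ 1#) × (∀ i → x i ≡ ∑ (λ j → μ j * V j i))

  IsPolytope : ∀ {m} → (Pt m → Set) → Set
  IsPolytope {m} P = Σ ℕ λ k → Σ (Fin k → Pt m) λ V → ∀ x → P x ⇔ InConvHull V x

  IsMetric : ∀ {n} → (Fin n → Fin n → Carrier) → Set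
  IsMetric κ =
    (∀ A B → 0# ≤ κ A B) × (∀ A → κ A A ≡ 0#) × (∀ A B → κ A B ≡ 0# → A ≡ B)
    × (∀ A B → κ A B ≡ κ B A) × (∀ A B C → κ A C ≤ κ A B + κ B C)

  IsDistribution : ∀ {n} → (Fin n → Carrier) → Set
  IsDistribution p = (∀ A → 0# ≤ p A) × (∑ p ≡ 1#)

  InΓ : ∀ {n} → (Fin n → Fin n → Carrier) → Carrier → (Fin n → Carrier)
        → (Fin n → Fin n → Carrier) → Set
  InΓ κ r p γ =
    (∀ A A' → 0# ≤ γ A A') × (∀ A → ∑ (γ A) ≤ p A)
    × (∑ (λ A → ∑ (λ A' → κ A A' * γ A A')) ≤ r)

  -- feasible set of z^short (M is the threshold λ r)
  InΓshort : ∀ {n} → (Fin n → Fin n → Carrier) → Carrier → Carrier → (Fin n → Carrier)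
             → (Fin n → Fin n → Carrier) → Set
  InΓshort κ r M p γ = InΓ κ r p γ × (∀ A A' → M < κ A A' → γ A A' ≡ 0#)

  InΓlong : ∀ {n} → (Fin n → Fin n → Carrier) → Carrier → Carrier → (Fin n → Carrier)
            → (Fin n → Fin n → Carrier) → Set
  InΓlong κ r lam p γ = InΓ κ r p γ × (∑ (λ A → ∑ (λ A' → γ A A')) ≤ lam ⁻¹)

  obj : ∀ {m n} → (Pt m → Fin n → Carrier) → Pt m → (Fin n → Fin n → Carrier) → Carrier
  obj g x γ = ∑ (λ A → ∑ (λ A' → γ A A' * g x A'))

  IsMax : ∀ {n} → ((Fin n → Fin n → Carrier) → Set) → ((Fin n → Fin n → Carrier) → Carrier)
          → Carrier → Set
  IsMax S f v = (Σ _ λ γ → S γ × (f γ ≡ v)) × (∀ γ → S γ → f γ ≤ v)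

module Submission where

-- Write  value γ f = ∑_{A,A'} γ_{A,A'} f(A')  and  mass γ = ∑_{A,A'} γ_{A,A'}.
-- Lower bound: split an optimal plan γ for z_p(x) at the threshold M = λr into
-- the part moving mass at distance ≤ M (a feasible short plan) and the part
-- moving mass farther than M.  The far part has transport cost at least
-- M · mass, so its mass is at most r / M = 1/λ: it is a feasible long plan.
-- Since g(x,·) ≤ g(0,·), its value at x is at most z^long_p(0).
-- Upper bound: every short plan is feasible, so z^short_p(x) ≤ z_p(x); and an
-- optimal long plan for z^long_p(0) is feasible, has mass ≤ 1/λ, and
-- g(0,·) ≤ g(x,·) + λ cᵀx, so z^long_p(0) ≤ z_p(x) + cᵀx.

open import Defs
open import Data.Nat using (ℕ)
open import Data.Fin using (Fin; zero; suc)
open import Data.Product using (_×_; _,_; proj₁; proj₂)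
open import Data.Sum using (_⊎_; inj₁; inj₂)
open import Data.Empty using (⊥-elim)
open import Function using (_∘_)
open import Relation.Nullary using (¬_)
open import Relation.Binary.PropositionalEquality
  using (_≡_; refl; sym; trans; cong; cong₂; subst; subst₂; module ≡-Reasoning)
open import Algebra.Bundles using (CommutativeRing)
open import Algebra.Structures using (IsCommutativeRing)
open import Relation.Binary.Structures using (IsTotalOrder)
import Algebra.Properties.CommutativeSemigroup as CommutativeSemigroupProperties
open import Relation.Binary.Bundles using (Poset)
import Relation.Binary.Reasoning.PartialOrder as PosetReasoning

module _ (F : OrderedField) where
  open OrderedField F
  open Ops F
  open IsCommutativeRing isCommutativeRing
    using (+-comm; +-assoc; *-comm; *-assoc; distribˡ; distribʳ; +-identityˡ; +-identityʳ;
           *-identityˡ; *-identityʳ; -‿inverseˡ; -‿inverseʳ; zeroˡ; zeroʳ)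
  open IsTotalOrder isTotalOrder
    using (total) renaming (reflexive to ≤-reflexive; trans to ≤-trans; antisym to ≤-antisym)

  poset : Poset _ _ _
  poset = record { Carrier = Carrier ; _≈_ = _≡_ ; _≤_ = _≤_
                 ; isPartialOrder = IsTotalOrder.isPartialOrder isTotalOrder }

  module ≤-Reasoning = PosetReasoning poset

  ring : CommutativeRing _ _
  ring = record { Carrier = Carrier ; _≈_ = _≡_ ; _+_ = _+_ ; _*_ = _*_ ; -_ = -_
                ; 0# = 0# ; 1# = 1# ; isCommutativeRing = isCommutativeRing }

  open CommutativeSemigroupProperties (CommutativeRing.+-commutativeSemigroup ring)
    using (interchange)

  ≤-refl : ∀ {a} → a ≤ a
  ≤-refl = ≤-reflexive refl

  +-mono : ∀ {a b c d} → a ≤ b → c ≤ d → a + c ≤ b + d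
  +-mono {a} {b} {c} {d} a≤b c≤d =
    ≤-trans (+-mono-≤ c a≤b) (subst₂ _≤_ (+-comm c b) (+-comm d b) (+-mono-≤ b c≤d))

  *-monoˡ : ∀ {k a b} → 0# ≤ k → a ≤ b → k * a ≤ k * b
  *-monoˡ {k} {a} {b} 0≤k a≤b =
    subst₂ _≤_ (+-identityˡ (k * a)) k[b-a]+ka≡kb
      (+-mono-≤ (k * a) (*-nonneg 0≤k 0≤b-a))
    where
    open ≡-Reasoning
    0≤b-a : 0# ≤ b + - a
    0≤b-a = subst (_≤ b + - a) (-‿inverseʳ a) (+-mono-≤ (- a) a≤b)
    k[b-a]+ka≡kb : k * (b + - a) + k * a ≡ k * b
    k[b-a]+ka≡kb = begin
      k * (b + - a) + k * a  ≡⟨ distribˡ k (b + - a) a ⟨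
      k * (b + - a + a)      ≡⟨ cong (k *_) (+-assoc b (- a) a) ⟩
      k * (b + (- a + a))    ≡⟨ cong (λ t → k * (b + t)) (-‿inverseˡ a) ⟩
      k * (b + 0#)           ≡⟨ cong (k *_) (+-identityʳ b) ⟩
      k * b                  ∎

  *-monoʳ : ∀ {k a b} → 0# ≤ k → a ≤ b → a * k ≤ b * k
  *-monoʳ {k} {a} {b} 0≤k a≤b = subst₂ _≤_ (*-comm k a) (*-comm k b) (*-monoˡ 0≤k a≤b)

  -- If 1 ≤ 0 then 0 ≤ -1, hence -1 = -1 * 1 ≤ -1 * 0 = 0, so -1 = 0 and 1 = 0.
  0≤1 : 0# ≤ 1#
  0≤1 with total 0# 1#
  ... | inj₁ 0≤1' = 0≤1'
  ... | inj₂ 1≤0 = ⊥-elim (0≢1 (sym 1≡0))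
    where
    open ≡-Reasoning
    0≤-1 : 0# ≤ - 1#
    0≤-1 = subst₂ _≤_ (-‿inverseʳ 1#) (+-identityˡ (- 1#)) (+-mono-≤ (- 1#) 1≤0)
    -1≤0 : - 1# ≤ 0#
    -1≤0 = subst₂ _≤_ (*-identityʳ (- 1#)) (zeroʳ (- 1#)) (*-monoˡ 0≤-1 1≤0)
    1≡0 : 1# ≡ 0#
    1≡0 = begin
      1#          ≡⟨ +-identityʳ 1# ⟨
      1# + 0#     ≡⟨ cong (1# +_) (≤-antisym 0≤-1 -1≤0) ⟩
      1# + - 1#   ≡⟨ -‿inverseʳ 1# ⟩
      0#          ∎

  ⁻¹-cancel : ∀ {a} b → ¬ (a ≡ 0#) → (a * b) * a ⁻¹ ≡ b
  ⁻¹-cancel {a} b a≢0 = begin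
    (a * b) * a ⁻¹  ≡⟨ cong (_* a ⁻¹) (*-comm a b) ⟩
    (b * a) * a ⁻¹  ≡⟨ *-assoc b a (a ⁻¹) ⟩
    b * (a * a ⁻¹)  ≡⟨ cong (b *_) (⁻¹-inverse a a≢0) ⟩
    b * 1#          ≡⟨ *-identityʳ b ⟩
    b               ∎
    where open ≡-Reasoning

  *-pos : ∀ {a b} → 0# < a → 0# < b → 0# < a * b
  *-pos {a} {b} (0≤a , 0≢a) (0≤b , 0≢b) = *-nonneg 0≤a 0≤b , 0≢ab
    where
    open ≡-Reasoning
    0≢ab : ¬ (0# ≡ a * b)
    0≢ab 0≡ab = 0≢b (sym (begin
      b               ≡⟨ ⁻¹-cancel b (0≢a ∘ sym) ⟨
      (a * b) * a ⁻¹  ≡⟨ cong (_* a ⁻¹) 0≡ab ⟨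
      0# * a ⁻¹       ≡⟨ zeroˡ (a ⁻¹) ⟩
      0#              ∎))

  1≤⇒pos : ∀ {a} → 1# ≤ a → 0# < a
  1≤⇒pos 1≤a = ≤-trans 0≤1 1≤a , λ 0≡a → 0≢1 (≤-antisym 0≤1 (subst (1# ≤_) (sym 0≡a) 1≤a))

  *-cancelˡ : ∀ {k a b} → 0# < k → k * a ≤ k * b → a ≤ b
  *-cancelˡ {k} {a} {b} (0≤k , 0≢k) ka≤kb with total a b
  ... | inj₁ a≤b = a≤b
  ... | inj₂ b≤a = ≤-reflexive (begin
    a                ≡⟨ ⁻¹-cancel a (0≢k ∘ sym) ⟨
    (k * a) * k ⁻¹   ≡⟨ cong (_* k ⁻¹) (≤-antisym ka≤kb (*-monoˡ 0≤k b≤a)) ⟩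
    (k * b) * k ⁻¹   ≡⟨ ⁻¹-cancel b (0≢k ∘ sym) ⟩
    b                ∎)
    where open ≡-Reasoning

  double : ∀ y → y + y ≡ (1# + 1#) * y
  double y = sym (trans (distribʳ y 1# 1#) (cong₂ _+_ (*-identityˡ y) (*-identityˡ y)))

  ∑-cong : ∀ {k} {f g : Fin k → Carrier} → (∀ i → f i ≡ g i) → ∑ f ≡ ∑ g
  ∑-cong {ℕ.zero} f≡g = refl
  ∑-cong {ℕ.suc k} f≡g = cong₂ _+_ (f≡g zero) (∑-cong (f≡g ∘ suc))

  ∑-mono : ∀ {k} {f g : Fin k → Carrier} → (∀ i → f i ≤ g i) → ∑ f ≤ ∑ g
  ∑-mono {ℕ.zero} f≤g = ≤-refl
  ∑-mono {ℕ.suc k} f≤g = +-mono (f≤g zero) (∑-mono (f≤g ∘ suc))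

  ∑-+ : ∀ {k} (f g : Fin k → Carrier) → ∑ (λ i → f i + g i) ≡ ∑ f + ∑ g
  ∑-+ {ℕ.zero} f g = sym (+-identityˡ 0#)
  ∑-+ {ℕ.suc k} f g =
    trans (cong ((f zero + g zero) +_) (∑-+ (f ∘ suc) (g ∘ suc))) (interchange _ _ _ _)

  ∑-* : ∀ {k} (c : Carrier) (f : Fin k → Carrier) → ∑ (λ i → c * f i) ≡ c * ∑ f
  ∑-* {ℕ.zero} c f = sym (zeroʳ c)
  ∑-* {ℕ.suc k} c f = trans (cong (c * f zero +_) (∑-* c (f ∘ suc))) (sym (distribˡ c _ _))

  ∑-nonneg : ∀ {k} {f : Fin k → Carrier} → (∀ i → 0# ≤ f i) → 0# ≤ ∑ f
  ∑-nonneg {k} {f} 0≤f = subst (_≤ ∑ f) (trans (∑-* 0# f) (zeroˡ (∑ f))) (∑-mono 0*f≤f)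
    where
    0*f≤f : ∀ i → 0# * f i ≤ f i
    0*f≤f i = subst (_≤ f i) (sym (zeroˡ (f i))) (0≤f i)

  dot-nonneg : ∀ {m} {c x : Pt m} → NonnegV c → NonnegV x → 0# ≤ dot c x
  dot-nonneg 0≤c 0≤x = ∑-nonneg (λ i → *-nonneg (0≤c i) (0≤x i))

  Plan : ℕ → Set
  Plan n = Fin n → Fin n → Carrier

  ∑∑ : ∀ {n} → Plan n → Carrier
  ∑∑ f = ∑ λ A → ∑ λ A' → f A A'

  ∑∑-cong : ∀ {n} {f g : Plan n} → (∀ A A' → f A A' ≡ g A A') → ∑∑ f ≡ ∑∑ g
  ∑∑-cong f≡g = ∑-cong λ A → ∑-cong (f≡g A)

  ∑∑-mono : ∀ {n} {f g : Plan n} → (∀ A A' → f A A' ≤ g A A') → ∑∑ f ≤ ∑∑ g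
  ∑∑-mono f≤g = ∑-mono λ A → ∑-mono (f≤g A)

  ∑∑-+ : ∀ {n} (f g : Plan n) → ∑∑ (λ A A' → f A A' + g A A') ≡ ∑∑ f + ∑∑ g
  ∑∑-+ f g = trans (∑-cong λ A → ∑-+ (f A) (g A)) (∑-+ (λ A → ∑ (f A)) (λ A → ∑ (g A)))

  ∑∑-* : ∀ {n} (c : Carrier) (f : Plan n) → ∑∑ (λ A A' → c * f A A') ≡ c * ∑∑ f
  ∑∑-* c f = trans (∑-cong λ A → ∑-* c (f A)) (∑-* c (λ A → ∑ (f A)))

  mass : ∀ {n} → Plan n → Carrier
  mass γ = ∑∑ γ

  -- value γ (g x) is definitionally the objective  obj g x γ.
  value : ∀ {n} → Plan n → (Fin n → Carrier) → Carrier
  value γ f = ∑∑ λ A A' → γ A A' * f A'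

  value-mono : ∀ {n} {γ : Plan n} {f f' : Fin n → Carrier} →
    (∀ A A' → 0# ≤ γ A A') → (∀ A' → f A' ≤ f' A') → value γ f ≤ value γ f'
  value-mono 0≤γ f≤f' = ∑∑-mono λ A A' → *-monoˡ (0≤γ A A') (f≤f' A')

  value-shift : ∀ {n} (γ : Plan n) (f : Fin n → Carrier) (t : Carrier) →
    value γ (λ A' → f A' + t) ≡ value γ f + t * mass γ
  value-shift γ f t = begin
    value γ (λ A' → f A' + t)                          ≡⟨ ∑∑-cong distribute ⟩
    ∑∑ (λ A A' → γ A A' * f A' + t * γ A A')
      ≡⟨ ∑∑-+ (λ A A' → γ A A' * f A') (λ A A' → t * γ A A') ⟩
    value γ f + ∑∑ (λ A A' → t * γ A A')               ≡⟨ cong (value γ f +_) (∑∑-* t γ) ⟩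
    value γ f + t * mass γ                             ∎
    where
    open ≡-Reasoning
    distribute : ∀ A A' → γ A A' * (f A' + t) ≡ γ A A' * f A' + t * γ A A'
    distribute A A' = trans (distribˡ (γ A A') (f A') t) (cong (γ A A' * f A' +_) (*-comm (γ A A') t))

  InΓ-downward : ∀ {n} {κ : Plan n} {r p} {γ δ : Plan n} → (∀ A A' → 0# ≤ κ A A') →
    InΓ κ r p γ → (∀ A A' → 0# ≤ δ A A') → (∀ A A' → δ A A' ≤ γ A A') → InΓ κ r p δ
  InΓ-downward 0≤κ (_ , rows , cost) 0≤δ δ≤γ =
    0≤δ , (λ A → ≤-trans (∑-mono (δ≤γ A)) (rows A)) ,
    ≤-trans (∑∑-mono λ A A' → *-monoˡ (0≤κ A A') (δ≤γ A A')) cost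

  near far : ∀ {a b : Carrier} → a ≤ b ⊎ b ≤ a → Carrier → Carrier
  near (inj₁ _) v = v
  near (inj₂ _) v = 0#
  far (inj₁ _) v = 0#
  far (inj₂ _) v = v

  near-bounds : ∀ {a b v} (s : a ≤ b ⊎ b ≤ a) → 0# ≤ v → (0# ≤ near s v) × (near s v ≤ v)
  near-bounds (inj₁ _) 0≤v = 0≤v , ≤-refl
  near-bounds (inj₂ _) 0≤v = ≤-refl , 0≤v

  far-bounds : ∀ {a b v} (s : a ≤ b ⊎ b ≤ a) → 0# ≤ v → (0# ≤ far s v) × (far s v ≤ v)
  far-bounds (inj₁ _) 0≤v = ≤-refl , 0≤v
  far-bounds (inj₂ _) 0≤v = 0≤v , ≤-refl

  near+far : ∀ {a b v} (s : a ≤ b ⊎ b ≤ a) w → v * w ≡ near s v * w + far s v * w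
  near+far {v = v} (inj₁ _) w = sym (trans (cong (v * w +_) (zeroˡ w)) (+-identityʳ _))
  near+far {v = v} (inj₂ _) w = sym (trans (cong (_+ v * w) (zeroˡ w)) (+-identityˡ _))

  near-vanishes : ∀ {a b v} (s : a ≤ b ⊎ b ≤ a) → b < a → near s v ≡ 0#
  near-vanishes (inj₁ a≤b) (b≤a , b≢a) = ⊥-elim (b≢a (≤-antisym b≤a a≤b))
  near-vanishes (inj₂ _) _ = refl

  far-cost : ∀ {a b v} (s : a ≤ b ⊎ b ≤ a) → 0# ≤ v → 0# ≤ a → b * far s v ≤ a * v
  far-cost {a} {b} {v} (inj₁ _) 0≤v 0≤a = subst (_≤ a * v) (sym (zeroʳ b)) (*-nonneg 0≤a 0≤v)
  far-cost (inj₂ b≤a) 0≤v _ = *-monoʳ 0≤v b≤a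

  module Split {n} (κ : Plan n) (M : Carrier) (γ : Plan n) where

    compare : ∀ A A' → κ A A' ≤ M ⊎ M ≤ κ A A'
    compare A A' = total (κ A A') M

    shortPart longPart : Plan n
    shortPart A A' = near (compare A A') (γ A A')
    longPart A A' = far (compare A A') (γ A A')

    value-split : ∀ f → value γ f ≡ value shortPart f + value longPart f
    value-split f =
      trans (∑∑-cong λ A A' → near+far (compare A A') (f A'))
            (∑∑-+ (λ A A' → shortPart A A' * f A') (λ A A' → longPart A A' * f A'))

    module _ {r p} (0≤κ : ∀ A A' → 0# ≤ κ A A') (feasible : InΓ κ r p γ) where

      0≤γ : ∀ A A' → 0# ≤ γ A A'
      0≤γ = proj₁ feasible

      shortPart-feasible : InΓshort κ r M p shortPart
      shortPart-feasible =
        InΓ-downward 0≤κ feasible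
          (λ A A' → proj₁ (near-bounds (compare A A') (0≤γ A A')))
          (λ A A' → proj₂ (near-bounds (compare A A') (0≤γ A A'))) ,
        λ A A' M<κ → near-vanishes (compare A A') M<κ

      longPart-feasible : InΓ κ r p longPart
      longPart-feasible =
        InΓ-downward 0≤κ feasible
          (λ A A' → proj₁ (far-bounds (compare A A') (0≤γ A A')))
          (λ A A' → proj₂ (far-bounds (compare A A') (0≤γ A A')))

      -- Moving mass farther than M costs at least M per unit.
      longPart-mass : M * mass longPart ≤ r
      longPart-mass =
        subst (_≤ r) (∑∑-* M longPart)
          (≤-trans (∑∑-mono λ A A' → far-cost (compare A A') (0≤γ A A') (0≤κ A A'))
                   (proj₂ (proj₂ feasible)))

  optimal≤short+long : ∀ {n} (κ : Plan n) (r lam : Carrier) (p : Fin n → Carrier)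
    (f f₀ : Fin n → Carrier) (zp zs zl : Carrier) →
    (∀ A A' → 0# ≤ κ A A') → 0# < lam → 0# < r →
    (∀ A → f A ≤ f₀ A) →
    IsMax (InΓ κ r p) (λ γ → value γ f) zp →
    (∀ δ → InΓshort κ r (lam * r) p δ → value δ f ≤ zs) →
    (∀ δ → InΓlong κ r lam p δ → value δ f₀ ≤ zl) →
    zp ≤ zs + zl
  optimal≤short+long κ r lam p f f₀ zp zs zl 0≤κ 0<lam 0<r f≤f₀
                     ((γ , feasible , value≡zp) , _) short≤zs long≤zl =
    subst (_≤ zs + zl) (trans (sym (value-split f)) value≡zp) (+-mono shortBound longBound)
    where
    open Split κ (lam * r) γ
    longPart-light : mass longPart ≤ lam ⁻¹
    longPart-light =
      *-cancelˡ (*-pos 0<lam 0<r)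
        (subst (lam * r * mass longPart ≤_) (sym (⁻¹-cancel r (proj₂ 0<lam ∘ sym)))
               (longPart-mass 0≤κ feasible))
    shortBound : value shortPart f ≤ zs
    shortBound = short≤zs shortPart (shortPart-feasible 0≤κ feasible)
    longBound : value longPart f ≤ zl
    longBound =
      ≤-trans (value-mono (proj₁ (longPart-feasible 0≤κ feasible)) f≤f₀)
              (long≤zl longPart (longPart-feasible 0≤κ feasible , longPart-light))

  short≤optimal : ∀ {n} (κ : Plan n) (r M : Carrier) (p f : Fin n → Carrier) (zp zs : Carrier) →
    (∀ δ → InΓ κ r p δ → value δ f ≤ zp) →
    IsMax (InΓshort κ r M p) (λ γ → value γ f) zs →
    zs ≤ zp
  short≤optimal κ r M p f zp zs optimal ((γ , (feasible , _) , value≡zs) , _) =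
    subst (_≤ zp) value≡zs (optimal γ feasible)

  -- Upper bound, long part: if f₀ ≤ f + λ t with t ≥ 0, then z^long(f₀) ≤ z_p(f) + t,
  -- because a long plan has mass at most 1/λ.
  long≤optimal+shift : ∀ {n} (κ : Plan n) (r lam : Carrier) (p f f₀ : Fin n → Carrier)
    (t zp zl : Carrier) → 0# < lam → 0# ≤ t → (∀ A → f₀ A ≤ f A + lam * t) →
    (∀ δ → InΓ κ r p δ → value δ f ≤ zp) →
    IsMax (InΓlong κ r lam p) (λ γ → value γ f₀) zl →
    zl ≤ zp + t
  long≤optimal+shift κ r lam p f f₀ t zp zl (0≤lam , 0≢lam) 0≤t f₀≤f+λt optimal
                     ((γ , (feasible , light) , value≡zl) , _) =
    subst (_≤ zp + t) value≡zl (begin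
      value γ f₀                          ≤⟨ value-mono (proj₁ feasible) f₀≤f+λt ⟩
      value γ (λ A → f A + lam * t)       ≡⟨ value-shift γ f (lam * t) ⟩
      value γ f + lam * t * mass γ        ≤⟨ +-mono (optimal γ feasible) shiftBound ⟩
      zp + t                              ∎)
    where
    open ≤-Reasoning
    shiftBound : lam * t * mass γ ≤ t
    shiftBound = subst (lam * t * mass γ ≤_) (⁻¹-cancel t (0≢lam ∘ sym))
                       (*-monoˡ (*-nonneg 0≤lam 0≤t) light)

lemma3p4 : (F : OrderedField) → let open OrderedField F in let open Ops F in
    (m n : ℕ) (P : Pt m → Set) → IsPolytope P → (∀ x → P x → NonnegV x) → P 0v →
    (c : Pt m) → NonnegV c → (lam : Carrier) → 1# ≤ lam →
    (g : Pt m → Fin n → Carrier) →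
    (∀ x A → P x → 0# ≤ g x A) →
    (∀ x A → P x → (g x A ≤ g 0v A) × (g 0v A ≤ g x A + lam * dot c x)) →
    (κ : Fin n → Fin n → Carrier) → IsMetric κ →
    (r : Carrier) → 0# < r →
    (p : Fin n → Carrier) → IsDistribution p →
    (x : Pt m) → P x →
    (zp zs zl : Carrier) →
    IsMax (InΓ κ r p) (obj g x) zp →
    IsMax (InΓshort κ r (lam * r) p) (obj g x) zs →
    IsMax (InΓlong κ r lam p) (obj g 0v) zl →
    (dot c x + zp ≤ dot c x + zs + zl)
    × (dot c x + zs + zl ≤ (1# + 1#) * (dot c x + zp))
lemma3p4 F _ _ _ _ nonnegP _ c 0≤c lam 1≤lam g _ g-bounds κ (0≤κ , _) r 0<r p _ x Px zp zs zl
         optimal short long = lower , upper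
  where
  open OrderedField F
  open Ops F
  open IsCommutativeRing isCommutativeRing using (+-assoc; +-comm)
  d : Carrier
  d = dot c x
  0<lam : 0# < lam
  0<lam = 1≤⇒pos F 1≤lam
  zp≤zs+zl : zp ≤ zs + zl
  zp≤zs+zl = optimal≤short+long F κ r lam p (g x) (g 0v) zp zs zl 0≤κ 0<lam 0<r
               (λ A → proj₁ (g-bounds x A Px))
               optimal (proj₂ short) (proj₂ long)
  zs≤zp : zs ≤ zp
  zs≤zp = short≤optimal F κ r (lam * r) p (g x) zp zs (proj₂ optimal) short
  zl≤zp+d : zl ≤ zp + d
  zl≤zp+d = long≤optimal+shift F κ r lam p (g x) (g 0v) d zp zl 0<lam
              (dot-nonneg F 0≤c (nonnegP x Px)) (λ A → proj₂ (g-bounds x A Px))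
              (proj₂ optimal) long
  lower : d + zp ≤ d + zs + zl
  lower = subst (d + zp ≤_) (sym (+-assoc d zs zl)) (+-mono F (≤-refl F) zp≤zs+zl)
  upper : d + zs + zl ≤ (1# + 1#) * (d + zp)
  upper = subst (d + zs + zl ≤_) (trans (cong ((d + zp) +_) (+-comm zp d)) (double F (d + zp)))
                (+-mono F (+-mono F (≤-refl F) zs≤zp) zl≤zp+d)
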